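{- Let $\mathbf{A}$ be a residuated lattice and $F$ a meet irreducible element of the lattice $\mathrm{Fi}_{\ast}\mathbf{A}$. Then in the pointed lattice $\mathbf{A}/\mathrm{L}\Theta(F)$ the element $\mathsf{1}/\mathrm{L}\Theta(F)$ is join irreducible.
   Context: A residuated lattice is an algebra $\langle A; \wedge, \vee, \cdot, \mathsf{1}, \backslash, / \rangle$ with a lattice reduct, a monoid reduct $\langle A;\cdot,\mathsf{1}\rangle$, and $x \leq z/y \iff x\cdot y \leq z \iff y \leq x\backslash z$. A multiplicative $\mathsf{1}$-filter is a lattice filter containing $\mathsf{1}$ and closed under $\cdot$; $\mathrm{Fi}_{\ast}\mathbf{A}$ is the lattice of these under inclusion. An element $a$ of a lattice is meet irreducible if $x\wedge y=a$ implies $x=a$ or $y=a$, and join irreducible if $x\vee y=a$ implies $x=a$ or $y=a$. $\mathrm{L}\Theta(F)$ is the lattice congruence $\{\langle x,y\rangle: x\backslash y\in F, y\backslash x\in F\}$, and $\mathbf{A}/\mathrm{L}\Theta(F)$ is the quotient of the pointed lattice reduct $\langle A;\wedge,\vee,\mathsf{1}\rangle$. -}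

module Defs where

open import Level using (Level; suc; _⊔_)
open import Data.Product using (_×_)
open import Data.Sum using (_⊎_)
open import Relation.Binary.PropositionalEquality using (_≡_)
open import Relation.Unary using (Pred; _∈_; _⊆_)

record ResiduatedLattice (a : Level) : Set (suc a) where
  infixr 7 _∙_ _\\_ _//_
  infixr 6 _∧_
  infixr 5 _∨_
  infix 4 _≤_
  field
    Carrier : Set a
    _∧_ _∨_ _∙_ _\\_ _//_ : Carrier → Carrier → Carrier
    one : Carrier
    ∧-comm : ∀ x y → x ∧ y ≡ y ∧ x
    ∨-comm : ∀ x y → x ∨ y ≡ y ∨ x
    ∧-assoc : ∀ x y z → (x ∧ y) ∧ z ≡ x ∧ (y ∧ z)
    ∨-assoc : ∀ x y z → (x ∨ y) ∨ z ≡ x ∨ (y ∨ z)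
    ∧-absorbs-∨ : ∀ x y → x ∧ (x ∨ y) ≡ x
    ∨-absorbs-∧ : ∀ x y → x ∨ (x ∧ y) ≡ x
    ∙-assoc : ∀ x y z → (x ∙ y) ∙ z ≡ x ∙ (y ∙ z)
    ∙-identityˡ : ∀ x → one ∙ x ≡ x
    ∙-identityʳ : ∀ x → x ∙ one ≡ x

  _≤_ : Carrier → Carrier → Set a
  x ≤ y = x ∧ y ≡ x

  field
    resʳ-to   : ∀ x y z → x ≤ z // y → x ∙ y ≤ z
    resʳ-from : ∀ x y z → x ∙ y ≤ z → x ≤ z // y
    resˡ-to   : ∀ x y z → y ≤ x \\ z → x ∙ y ≤ z
    resˡ-from : ∀ x y z → x ∙ y ≤ z → y ≤ x \\ z

module _ {a : Level} (A : ResiduatedLattice a) where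
  open ResiduatedLattice A

  record IsMulFilter (F : Pred Carrier a) : Set a where
    field
      up     : ∀ {x y} → x ∈ F → x ≤ y → y ∈ F
      ∧-closed : ∀ {x y} → x ∈ F → y ∈ F → (x ∧ y) ∈ F
      one∈   : one ∈ F
      ∙-closed : ∀ {x y} → x ∈ F → y ∈ F → (x ∙ y) ∈ F

  _≐_ : Pred Carrier a → Pred Carrier a → Set a
  F ≐ G = F ⊆ G × G ⊆ F

  IsMeetIn-Fi : Pred Carrier a → Pred Carrier a → Pred Carrier a → Set (suc a)
  IsMeetIn-Fi F G H =
    F ⊆ G × F ⊆ H ×
    (∀ (K : Pred Carrier a) → IsMulFilter K → K ⊆ G → K ⊆ H → K ⊆ F)

  MeetIrreducible-Fi : Pred Carrier a → Set (suc a)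
  MeetIrreducible-Fi F =
    ∀ (G H : Pred Carrier a) → IsMulFilter G → IsMulFilter H →
    IsMeetIn-Fi F G H → G ≐ F ⊎ H ≐ F

  LΘ : Pred Carrier a → Carrier → Carrier → Set a
  LΘ F x y = (x \\ y) ∈ F × (y \\ x) ∈ F

  -- in A / LΘ(F) the class of 1 is join irreducible:
  -- [x] ∨ [y] = [x ∨ y] = [1] implies [x] = [1] or [y] = [1]
  OneClassJoinIrreducible : Pred Carrier a → Set a
  OneClassJoinIrreducible F =
    ∀ x y → LΘ F (x ∨ y) one → LΘ F x one ⊎ LΘ F y one

{-# OPTIONS --safe #-}
-- Write κ x = x ∧ (x \ 1) ∧ 1, so that x ≡ 1 (mod LΘ F) iff κ x ∈ F, and let F⟨b⟩ be the
-- multiplicative 1-filter generated by F and a negative element b. If x ∨ y ≡ 1 (mod LΘ F),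
-- then every h ∈ F below κ (x ∨ y) satisfies h h h ≤ h x h ∨ h y h ≤ κ x ∨ κ y; since for
-- negative p, q one has (p ∨ q)^(n+m) ≤ p^n ∨ q^m, this shows F⟨κ x⟩ ∩ F⟨κ y⟩ = F. By meet
-- irreducibility F⟨κ x⟩ = F or F⟨κ y⟩ = F, i.e. κ x ∈ F or κ y ∈ F.
module Submission where

open import Level using (Level)
open import Relation.Unary using (Pred; _∈_; _⊆_)
open import Defs
open import Algebra.Bundles using (Monoid)
open import Algebra.Lattice.Bundles using (Lattice)
import Algebra.Lattice.Properties.Lattice as LatticeProperties
import Algebra.Properties.Monoid.Mult as MonoidPowers
open import Data.Nat using (ℕ; zero; suc; _+_)
open import Data.Nat.Properties using (+-suc)
open import Data.Product using (∃-syntax; _×_; _,_; proj₁)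
import Data.Sum as Sum
open import Relation.Binary.Bundles using (Poset)
import Relation.Binary.Lattice as OrderLattice
open import Relation.Binary.PropositionalEquality
  using (_≡_; refl; sym; cong₂; subst; isEquivalence)

module ResiduatedLatticeProperties {a : Level} (A : ResiduatedLattice a) where
  open ResiduatedLattice A

  lattice : Lattice a a
  lattice = record
    { Carrier = Carrier
    ; _≈_ = _≡_
    ; _∨_ = _∨_
    ; _∧_ = _∧_
    ; isLattice = record
      { isEquivalence = isEquivalence
      ; ∨-comm = ∨-comm
      ; ∨-assoc = ∨-assoc
      ; ∨-cong = cong₂ _∨_
      ; ∧-comm = ∧-comm
      ; ∧-assoc = ∧-assoc
      ; ∧-cong = cong₂ _∧_
      ; absorptive = ∨-absorbs-∧ , ∧-absorbs-∨
      }
    }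

  -- The library orders a lattice by x ≈ x ∧ y, the symmetric form of x ≤ y.
  private
    module Ord = OrderLattice.Lattice
      (LatticeProperties.∨-∧-orderTheoreticLattice lattice)

  ≤-refl : ∀ {x} → x ≤ x
  ≤-refl = sym Ord.refl

  ≤-reflexive : ∀ {x y} → x ≡ y → x ≤ y
  ≤-reflexive refl = ≤-refl

  ≤-trans : ∀ {x y z} → x ≤ y → y ≤ z → x ≤ z
  ≤-trans x≤y y≤z = sym (Ord.trans (sym x≤y) (sym y≤z))

  ≤-antisym : ∀ {x y} → x ≤ y → y ≤ x → x ≡ y
  ≤-antisym x≤y y≤x = Ord.antisym (sym x≤y) (sym y≤x)

  ≤-poset : Poset a a a
  ≤-poset = record
    { Carrier = Carrier
    ; _≈_ = _≡_
    ; _≤_ = _≤_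
    ; isPartialOrder = record
      { isPreorder = record
        { isEquivalence = isEquivalence
        ; reflexive = ≤-reflexive
        ; trans = ≤-trans
        }
      ; antisym = ≤-antisym
      }
    }

  open import Relation.Binary.Reasoning.PartialOrder ≤-poset

  x∧y≤x : ∀ {x y} → x ∧ y ≤ x
  x∧y≤x = sym (Ord.x∧y≤x _ _)

  x∧y≤y : ∀ {x y} → x ∧ y ≤ y
  x∧y≤y = sym (Ord.x∧y≤y _ _)

  ∧-greatest : ∀ {x y z} → x ≤ y → x ≤ z → x ≤ y ∧ z
  ∧-greatest x≤y x≤z = sym (Ord.∧-greatest (sym x≤y) (sym x≤z))

  x≤x∨y : ∀ {x y} → x ≤ x ∨ y
  x≤x∨y = sym (Ord.x≤x∨y _ _)

  y≤x∨y : ∀ {x y} → y ≤ x ∨ y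
  y≤x∨y = sym (Ord.y≤x∨y _ _)

  ∨-least : ∀ {x y z} → x ≤ z → y ≤ z → x ∨ y ≤ z
  ∨-least x≤z y≤z = sym (Ord.∨-least (sym x≤z) (sym y≤z))

  ∨-mono : ∀ {x y u v} → x ≤ u → y ≤ v → x ∨ y ≤ u ∨ v
  ∨-mono x≤u y≤v = ∨-least (≤-trans x≤u x≤x∨y) (≤-trans y≤v y≤x∨y)

  ∙-monoˡ : ∀ {x y} z → x ≤ y → x ∙ z ≤ y ∙ z
  ∙-monoˡ {x} {y} z x≤y = resʳ-to x z (y ∙ z) (≤-trans x≤y (resʳ-from y z (y ∙ z) ≤-refl))

  ∙-monoʳ : ∀ {x y} z → x ≤ y → z ∙ x ≤ z ∙ y
  ∙-monoʳ {x} {y} z x≤y = resˡ-to z x (z ∙ y) (≤-trans x≤y (resˡ-from z y (z ∙ y) ≤-refl))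

  ∙-mono : ∀ {x y u v} → x ≤ u → y ≤ v → x ∙ y ≤ u ∙ v
  ∙-mono {y = y} {u = u} x≤u y≤v = ≤-trans (∙-monoˡ y x≤u) (∙-monoʳ u y≤v)

  ∙-distribʳ-∨ : ∀ x y z → (x ∨ y) ∙ z ≤ x ∙ z ∨ y ∙ z
  ∙-distribʳ-∨ x y z = resʳ-to (x ∨ y) z _
    (∨-least (resʳ-from x z _ x≤x∨y) (resʳ-from y z _ y≤x∨y))

  ∙-distribˡ-∨ : ∀ x y z → z ∙ (x ∨ y) ≤ z ∙ x ∨ z ∙ y
  ∙-distribˡ-∨ x y z = resˡ-to z (x ∨ y) _
    (∨-least (resˡ-from z x _ x≤x∨y) (resˡ-from z y _ y≤x∨y))

  \\-antitoneˡ : ∀ {x y} z → x ≤ y → y \\ z ≤ x \\ z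
  \\-antitoneˡ {x} {y} z x≤y = resˡ-from x (y \\ z) z
    (≤-trans (∙-monoˡ (y \\ z) x≤y) (resˡ-to y (y \\ z) z ≤-refl))

  one\\x≤x : ∀ x → one \\ x ≤ x
  one\\x≤x x = subst (_≤ x) (∙-identityˡ (one \\ x)) (resˡ-to one (one \\ x) x ≤-refl)

  x≤one\\x : ∀ x → x ≤ one \\ x
  x≤one\\x x = resˡ-from one x x (≤-reflexive (∙-identityˡ x))

  ∙-decreasingˡ : ∀ {p} x → p ≤ one → p ∙ x ≤ x
  ∙-decreasingˡ {p} x p≤one = subst (p ∙ x ≤_) (∙-identityˡ x) (∙-monoˡ x p≤one)

  ∙-decreasingʳ : ∀ {p} x → p ≤ one → x ∙ p ≤ x
  ∙-decreasingʳ {p} x p≤one = subst (x ∙ p ≤_) (∙-identityʳ x) (∙-monoʳ x p≤one)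

  ∙-≤-∧ : ∀ {p q} → p ≤ one → q ≤ one → p ∙ q ≤ p ∧ q
  ∙-≤-∧ {p} {q} p≤one q≤one = ∧-greatest (∙-decreasingʳ p q≤one) (∙-decreasingˡ q p≤one)

  monoid : Monoid a a
  monoid = record
    { Carrier = Carrier
    ; _≈_ = _≡_
    ; _∙_ = _∙_
    ; ε = one
    ; isMonoid = record
      { isSemigroup = record
        { isMagma = record { isEquivalence = isEquivalence ; ∙-cong = cong₂ _∙_ }
        ; assoc = ∙-assoc
        }
      ; identity = ∙-identityˡ , ∙-identityʳ
      }
    }

  open MonoidPowers monoid using (×-homo-+) renaming (_×_ to _times_)

  infixr 8 _^_
  _^_ : Carrier → ℕ → Carrier
  x ^ n = n times x

  ^-homo-+ : ∀ x m n → x ^ (m + n) ≡ x ^ m ∙ x ^ n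
  ^-homo-+ x = ×-homo-+ x

  ^-monoˡ : ∀ {x y} n → x ≤ y → x ^ n ≤ y ^ n
  ^-monoˡ zero    x≤y = ≤-refl
  ^-monoˡ (suc n) x≤y = ∙-mono x≤y (^-monoˡ n x≤y)

  ^-≤-one : ∀ {p} n → p ≤ one → p ^ n ≤ one
  ^-≤-one zero    p≤one = ≤-refl
  ^-≤-one {p} (suc n) p≤one = ≤-trans (∙-decreasingˡ (p ^ n) p≤one) (^-≤-one n p≤one)

  ^-+-≤-∧ : ∀ {p} m n → p ≤ one → p ^ (m + n) ≤ p ^ m ∧ p ^ n
  ^-+-≤-∧ {p} m n p≤one = begin
    p ^ (m + n)     ≡⟨ ^-homo-+ p m n ⟩
    p ^ m ∙ p ^ n   ≤⟨ ∙-≤-∧ (^-≤-one m p≤one) (^-≤-one n p≤one) ⟩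
    p ^ m ∧ p ^ n   ∎

  -- Expand (p ∨ q)^(m+n) into words; each word has at least m letters p or n letters q, and
  -- dropping the remaining (negative) letters only makes it larger.
  ∨-^-+ : ∀ {p q} → p ≤ one → q ≤ one → ∀ m n → (p ∨ q) ^ (m + n) ≤ p ^ m ∨ q ^ n
  ∨-^-+ p≤one q≤one zero n = ≤-trans (^-≤-one n (∨-least p≤one q≤one)) x≤x∨y
  ∨-^-+ p≤one q≤one (suc m) zero = ≤-trans (^-≤-one (suc m + zero) (∨-least p≤one q≤one)) y≤x∨y
  ∨-^-+ {p} {q} p≤one q≤one (suc m) (suc n) = begin
    (p ∨ q) ∙ r                                   ≤⟨ ∙-distribʳ-∨ p q r ⟩
    p ∙ r ∨ q ∙ r                                 ≤⟨ ∨-mono (∙-monoʳ p pStep) (∙-monoʳ q qStep) ⟩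
    p ∙ (p ^ m ∨ q ^ suc n) ∨ q ∙ (p ^ suc m ∨ q ^ n)
      ≤⟨ ∨-mono (∙-distribˡ-∨ _ _ p) (∙-distribˡ-∨ _ _ q) ⟩
    (p ^ suc m ∨ p ∙ q ^ suc n) ∨ (q ∙ p ^ suc m ∨ q ^ suc n)
      ≤⟨ ∨-mono (∨-mono ≤-refl (∙-decreasingˡ _ p≤one)) (∨-mono (∙-decreasingˡ _ q≤one) ≤-refl) ⟩
    (p ^ suc m ∨ q ^ suc n) ∨ (p ^ suc m ∨ q ^ suc n) ≤⟨ ∨-least ≤-refl ≤-refl ⟩
    p ^ suc m ∨ q ^ suc n                         ∎
    where
    r : Carrier
    r = (p ∨ q) ^ (m + suc n)
    pStep : r ≤ p ^ m ∨ q ^ suc n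
    pStep = ∨-^-+ p≤one q≤one m (suc n)
    qStep : r ≤ p ^ suc m ∨ q ^ n
    qStep = subst (λ k → (p ∨ q) ^ k ≤ p ^ suc m ∨ q ^ n) (sym (+-suc m n))
      (∨-^-+ p≤one q≤one (suc m) n)

  κ : Carrier → Carrier
  κ x = x ∧ (x \\ one) ∧ one

  κ≤x : ∀ {x} → κ x ≤ x
  κ≤x = x∧y≤x

  κ≤x\\one : ∀ {x} → κ x ≤ x \\ one
  κ≤x\\one = ≤-trans x∧y≤y x∧y≤x

  κ≤one : ∀ {x} → κ x ≤ one
  κ≤one = ≤-trans x∧y≤y x∧y≤y

  ≤-κ : ∀ {h x} → h ≤ x → h ≤ x \\ one → h ≤ one → h ≤ κ x
  ≤-κ h≤x h≤x\\one h≤one = ∧-greatest h≤x (∧-greatest h≤x\\one h≤one)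

  conjugate-≤-κ : ∀ {x h} → h ≤ one → h ≤ x \\ one → h ∙ x ∙ h ≤ h ∧ κ x
  conjugate-≤-κ {x} {h} h≤one h≤x\\one =
    ∧-greatest hxh≤h (≤-κ hxh≤x hxh≤x\\one (≤-trans hxh≤h h≤one))
    where
    xh≤one : x ∙ h ≤ one
    xh≤one = resˡ-to x h one h≤x\\one
    hxh≤h : h ∙ x ∙ h ≤ h
    hxh≤h = ∙-decreasingʳ h xh≤one
    hxh≤x : h ∙ x ∙ h ≤ x
    hxh≤x = ≤-trans (∙-decreasingˡ (x ∙ h) h≤one) (∙-decreasingʳ x h≤one)
    hxh≤x\\one : h ∙ x ∙ h ≤ x \\ one
    hxh≤x\\one = resˡ-from x _ one (begin
      x ∙ h ∙ x ∙ h     ≡⟨ ∙-assoc x h (x ∙ h) ⟨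
      (x ∙ h) ∙ x ∙ h   ≤⟨ ∙-decreasingˡ (x ∙ h) xh≤one ⟩
      x ∙ h             ≤⟨ xh≤one ⟩
      one               ∎)

  cube-≤-κ-∨ : ∀ {x y h} → h ≤ κ (x ∨ y) → h ∙ h ∙ h ≤ (h ∧ κ x) ∨ (h ∧ κ y)
  cube-≤-κ-∨ {x} {y} {h} h≤κ = begin
    h ∙ h ∙ h               ≤⟨ ∙-monoʳ h (∙-monoˡ h (≤-trans h≤κ κ≤x)) ⟩
    h ∙ (x ∨ y) ∙ h         ≤⟨ ∙-monoʳ h (∙-distribʳ-∨ x y h) ⟩
    h ∙ (x ∙ h ∨ y ∙ h)     ≤⟨ ∙-distribˡ-∨ _ _ h ⟩
    h ∙ x ∙ h ∨ h ∙ y ∙ h   ≤⟨ ∨-mono (conjugate-≤-κ h≤one (h≤\\one x≤x∨y))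
                                      (conjugate-≤-κ h≤one (h≤\\one y≤x∨y)) ⟩
    (h ∧ κ x) ∨ (h ∧ κ y)   ∎
    where
    h≤one : h ≤ one
    h≤one = ≤-trans h≤κ κ≤one
    h≤\\one : ∀ {z} → z ≤ x ∨ y → h ≤ z \\ one
    h≤\\one z≤x∨y = ≤-trans (≤-trans h≤κ κ≤x\\one) (\\-antitoneˡ one z≤x∨y)

  module Filter (F : Pred Carrier a) (isFilter : IsMulFilter A F) where
    open IsMulFilter isFilter

    ^-closed : ∀ {x} n → x ∈ F → x ^ n ∈ F
    ^-closed zero    _   = one∈
    ^-closed (suc n) x∈F = ∙-closed x∈F (^-closed n x∈F)

    κ∈⇒LΘ-one : ∀ {x} → κ x ∈ F → LΘ A F x one
    κ∈⇒LΘ-one κx∈F = up κx∈F κ≤x\\one , up κx∈F (≤-trans κ≤x (x≤one\\x _))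

    LΘ-one⇒κ∈ : ∀ {x} → LΘ A F x one → κ x ∈ F
    LΘ-one⇒κ∈ {x} (x\\one∈F , one\\x∈F) =
      ∧-closed (up one\\x∈F (one\\x≤x x)) (∧-closed x\\one∈F one∈)

    -- For negative b, the multiplicative 1-filter generated by F ∪ {b}.
    ⟨_⟩ : Carrier → Pred Carrier a
    ⟨ b ⟩ z = ∃[ f ] f ∈ F × ∃[ n ] (f ∧ b) ^ n ≤ z

    ⟨⟩-isMulFilter : ∀ {b} → b ≤ one → IsMulFilter A ⟨ b ⟩
    ⟨⟩-isMulFilter {b} b≤one = record
      { up = λ { (f , f∈F , n , fbⁿ≤z) z≤w → f , f∈F , n , ≤-trans fbⁿ≤z z≤w }
      ; ∧-closed = λ { (f , f∈F , n , fbⁿ≤z) (g , g∈F , m , gbᵐ≤w) →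
          f ∧ g , ∧-closed f∈F g∈F , n + m ,
          ≤-trans (^-+-≤-∧ n m c≤one)
            (∧-greatest (≤-trans x∧y≤x (^-bound n c≤f∧b fbⁿ≤z))
                        (≤-trans x∧y≤y (^-bound m c≤g∧b gbᵐ≤w))) }
      ; one∈ = one , one∈ , 0 , ≤-refl
      ; ∙-closed = λ { (f , f∈F , n , fbⁿ≤z) (g , g∈F , m , gbᵐ≤w) →
          f ∧ g , ∧-closed f∈F g∈F , n + m ,
          ≤-trans (≤-reflexive (^-homo-+ _ n m))
            (∙-mono (^-bound n c≤f∧b fbⁿ≤z) (^-bound m c≤g∧b gbᵐ≤w)) }
      }
      where
      c≤one : ∀ {f g} → (f ∧ g) ∧ b ≤ one
      c≤one = ≤-trans x∧y≤y b≤one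
      c≤f∧b : ∀ {f g} → (f ∧ g) ∧ b ≤ f ∧ b
      c≤f∧b = ∧-greatest (≤-trans x∧y≤x x∧y≤x) x∧y≤y
      c≤g∧b : ∀ {f g} → (f ∧ g) ∧ b ≤ g ∧ b
      c≤g∧b = ∧-greatest (≤-trans x∧y≤x x∧y≤y) x∧y≤y
      ^-bound : ∀ {c d z} n → c ≤ d → d ^ n ≤ z → c ^ n ≤ z
      ^-bound n c≤d dⁿ≤z = ≤-trans (^-monoˡ n c≤d) dⁿ≤z

    F⊆⟨⟩ : ∀ {b} → F ⊆ ⟨ b ⟩
    F⊆⟨⟩ z∈F = _ , z∈F , 1 , ≤-trans (∙-decreasingʳ _ ≤-refl) x∧y≤x

    ∈⟨⟩ : ∀ {b} → b ∈ ⟨ b ⟩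
    ∈⟨⟩ = one , one∈ , 1 , ≤-trans (∙-decreasingʳ _ ≤-refl) x∧y≤y

    ⟨κ⟩-∩-⊆ : ∀ {x y} → κ (x ∨ y) ∈ F → ∀ {z} → z ∈ ⟨ κ x ⟩ → z ∈ ⟨ κ y ⟩ → z ∈ F
    ⟨κ⟩-∩-⊆ {x} {y} κ∈F {z} (f , f∈F , n , fκˣ≤z) (g , g∈F , m , gκʸ≤z) =
      up (^-closed (n + m) (∙-closed h∈F (∙-closed h∈F h∈F))) (begin
        (h ∙ h ∙ h) ^ (n + m)                   ≤⟨ ^-monoˡ (n + m) (cube-≤-κ-∨ h≤κ) ⟩
        (p ∨ q) ^ (n + m)                       ≤⟨ ∨-^-+ (≤-trans x∧y≤x h≤one)
                                                         (≤-trans x∧y≤x h≤one) n m ⟩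
        p ^ n ∨ q ^ m                           ≤⟨ ∨-mono (^-monoˡ n p≤f∧κx) (^-monoˡ m q≤g∧κy) ⟩
        (f ∧ κ x) ^ n ∨ (g ∧ κ y) ^ m           ≤⟨ ∨-least fκˣ≤z gκʸ≤z ⟩
        z                                       ∎)
      where
      h p q : Carrier
      h = (f ∧ g) ∧ κ (x ∨ y)
      p = h ∧ κ x
      q = h ∧ κ y
      h∈F : h ∈ F
      h∈F = ∧-closed (∧-closed f∈F g∈F) κ∈F
      h≤κ : h ≤ κ (x ∨ y)
      h≤κ = x∧y≤y
      h≤one : h ≤ one
      h≤one = ≤-trans h≤κ κ≤one
      p≤f∧κx : p ≤ f ∧ κ x
      p≤f∧κx = ∧-greatest (≤-trans x∧y≤x (≤-trans x∧y≤x x∧y≤x)) x∧y≤y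
      q≤g∧κy : q ≤ g ∧ κ y
      q≤g∧κy = ∧-greatest (≤-trans x∧y≤x (≤-trans x∧y≤x x∧y≤y)) x∧y≤y

lemma3p16 : ∀ {a : Level} (A : ResiduatedLattice a) (F : Pred (ResiduatedLattice.Carrier A) a) →
    IsMulFilter A F → MeetIrreducible-Fi A F → OneClassJoinIrreducible A F
lemma3p16 A F isFilter irreducible x y x∨y≡one =
  Sum.map (λ ⟨κx⟩≐F → κ∈⇒LΘ-one (proj₁ ⟨κx⟩≐F ∈⟨⟩)) (λ ⟨κy⟩≐F → κ∈⇒LΘ-one (proj₁ ⟨κy⟩≐F ∈⟨⟩))
    (irreducible ⟨ κ x ⟩ ⟨ κ y ⟩ (⟨⟩-isMulFilter κ≤one) (⟨⟩-isMulFilter κ≤one)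
      (F⊆⟨⟩ , F⊆⟨⟩ , λ _ _ K⊆⟨κx⟩ K⊆⟨κy⟩ z∈K → ⟨κ⟩-∩-⊆ κ[x∨y]∈F (K⊆⟨κx⟩ z∈K) (K⊆⟨κy⟩ z∈K)))
  where
  open ResiduatedLattice A using (_∨_)
  open ResiduatedLatticeProperties A
  open Filter F isFilter
  κ[x∨y]∈F : κ (x ∨ y) ∈ F
  κ[x∨y]∈F = LΘ-one⇒κ∈ x∨y≡one
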